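{- Let $G=(V,E)$ be a (finite, simple, connected) graph of order $n\ge 9$ such that $\tau(G)=\tau=n-4$ and its $\tau$-set $W$ satisfies $G[W]\cong K_\tau$. If $|N(W)\setminus W|=2$, then $\beta_p(G)=n-3$.
   Context: Two vertices $u,v$ are twins if $N(u)\setminus\{v\}=N(v)\setminus\{u\}$. A twin set is a set of pairwise twin vertices; twin classes are the equivalence classes of the twin relation and $\tau(G)$ is the maximum cardinality of a twin class. A $\tau$-set is a twin set of cardinality $\tau(G)$ (unique when $\tau(G)>n/2$). For $W\subseteq V$, $N(W)=\bigcup_{v\in W}N(v)$; $G[W]$ is the induced subgraph. For $u$ a vertex and $S$ a vertex set, $d(u,S)=\min_{w\in S}d(u,w)$. A partition $\Pi=\{S_1,\dots,S_k\}$ of $V$ is locating if the vectors $r(u|\Pi)=(d(u,S_1),\dots,d(u,S_k))$ are pairwise distinct over $u\in V$; $\beta_p(G)$ is the minimum size of a locating partition. -}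

module Defs where

open import Data.Nat using (ℕ; zero; suc; _≤_)
open import Data.Bool using (Bool; true; false)
open import Data.Fin using (Fin)
open import Data.Fin.Subset using (Subset; _∈_; _∉_; ∣_∣)
open import Data.Product using (Σ; ∃; _×_; _,_)
open import Relation.Binary.PropositionalEquality using (_≡_; _≢_)
open import Relation.Nullary using (¬_)

record Graph (n : ℕ) : Set where
  field
    adj    : Fin n → Fin n → Bool
    sym    : ∀ u v → adj u v ≡ adj v u
    irrefl : ∀ u → adj u u ≡ false

module _ {n : ℕ} (G : Graph n) where
  open Graph G

  Adj : Fin n → Fin n → Set
  Adj u v = adj u v ≡ true

  data Walk : Fin n → Fin n → ℕ → Set where
    nil  : ∀ {u} → Walk u u 0
    cons : ∀ {u v w k} → Adj u v → Walk v w k → Walk u w (suc k)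

  Connected : Set
  Connected = ∀ u v → ∃ λ k → Walk u v k

  DistToSet : (Fin n → Set) → Fin n → ℕ → Set
  DistToSet S u d =
    (∃ λ w → S w × Walk u w d) ×
    (∀ w k → S w → Walk u w k → d ≤ k)

  Twins : Fin n → Fin n → Set
  Twins u v = ∀ w → w ≢ u → w ≢ v → adj u w ≡ adj v w

  IsTwinSet : Subset n → Set
  IsTwinSet W = ∀ u v → u ∈ W → v ∈ W → Twins u v

  IsTwinClass : Subset n → Set
  IsTwinClass W = (∃ λ u → u ∈ W) × (∀ u v → u ∈ W → (v ∈ W → Twins u v) × (Twins u v → v ∈ W))

  TauEq : ℕ → Set
  TauEq t = (∃ λ W → IsTwinClass W × ∣ W ∣ ≡ t) × (∀ W → IsTwinClass W → ∣ W ∣ ≤ t)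

  InducesClique : Subset n → Set
  InducesClique W = ∀ u v → u ∈ W → v ∈ W → u ≢ v → Adj u v

  IsOpenNbhdMinus : Subset n → Subset n → Set
  IsOpenNbhdMinus W S =
    ∀ v → (v ∈ S → v ∉ W × (∃ λ w → w ∈ W × Adj w v)) ×
          (v ∉ W × (∃ λ w → w ∈ W × Adj w v) → v ∈ S)

  record Partition (k : ℕ) : Set where
    field
      cls  : Fin n → Fin k
      onto : ∀ i → ∃ λ v → cls v ≡ i

  Class : ∀ {k} → Partition k → Fin k → Fin n → Set
  Class P i v = Partition.cls P v ≡ i

  SameRep : ∀ {k} → Partition k → Fin n → Fin n → Set
  SameRep {k} P u v = ∀ (i : Fin k) d →
    (DistToSet (Class P i) u d → DistToSet (Class P i) v d) ×
    (DistToSet (Class P i) v d → DistToSet (Class P i) u d)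

  IsLocating : ∀ {k} → Partition k → Set
  IsLocating P = ∀ u v → SameRep P u v → u ≡ v

  PartitionDimEq : ℕ → Set
  PartitionDimEq m =
    (Σ (Partition m) IsLocating) ×
    (∀ k → (P : Partition k) → IsLocating P → m ≤ k)

module Submission where

-- Write S = {a, b} and let c, d be the two vertices outside N[W].
--
-- Lower bound: twins in the same class of a partition have the same distance
-- vector, so a locating partition puts the vertices of W in distinct classes; if W
-- met every class, then a, adjacent to all of W, would have the same vector as its
-- classmate in W.  Hence at least |W| + 1 = n - 3 classes are needed.
--
-- Upper bound: merge three disjoint pairs taken from a, b, c, d and four vertices
-- w₀, …, w₃ of W, keeping every other vertex as a singleton, with the pairs chosen
-- from the edges among a, b, c, d so that some class is at distance 1 from exactly
-- one member of each pair.  The edge patterns for which no such choice exists do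
-- not occur: either b (or a) is a twin of every vertex of W, which gives a twin
-- class larger than τ(G), or c and d are unreachable from W.

open import Defs
open import Data.Bool using (true) renaming (_≟_ to _≟ᵇ_)
open import Data.Bool.Properties using (¬-not)
open import Data.Fin using (Fin; zero; suc; _≟_; punchOut; splitAt; _↑ˡ_; _↑ʳ_)
open import Data.Fin.Patterns using (0F; 1F; 2F; 3F; 4F; 5F; 6F; 7F)
open import Data.Fin.Permutation using (Permutation′; transpose; _⟨$⟩ʳ_; _⟨$⟩ˡ_; inverseˡ; inverseʳ)
open import Data.Fin.Properties
  using (any?; all?; suc-injective; punchOut-injective; injective⇒≤; ↑ˡ-injective; splitAt⁻¹-↑ˡ; splitAt⁻¹-↑ʳ)
  renaming (0≢1+n to 0F≢1+i)
open import Data.Fin.Subset using (Subset; ∣_∣; _∈_; _∉_; _∪_; _-_; ⁅_⁆; ⊥; ∁; Nonempty; inside; outside)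
open import Data.Fin.Subset.Properties
  using ( p─⊥≡p; p─q⊆p; x∈p⇒∣p-x∣<∣p∣; nonempty?; Empty-unique; ∣⊥∣≡0; ∉⊥; x∈p∧x≢y⇒x∈p-y
        ; x∈⁅x⁆; x∈⁅y⁆⇒x≡y; ∣⁅x⁆∣≡1; x∈p∪q⁺; x∈p∪q⁻; x∈∁p⇒x∉p; x∉p⇒x∈∁p; ∣∁p∣≡n∸∣p∣; _∈?_)
open import Data.Nat using (ℕ; suc; _+_; _∸_; _≤_; _<_; z≤n; s≤s)
open import Data.Nat.Properties
  using ( ≤-refl; ≤-trans; ≤-antisym; m≤m+n; n≤1+n; +-suc; +-comm; +-assoc; 1+n≰n; n≮0; ≤∧≢⇒<; 0≢1+n
        ; m+n∸m≡n; m∸n+n≡m; m+[n∸m]≡n; +-∸-assoc; ∸-monoˡ-≤)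
  renaming (suc-injective to ℕ-suc-injective)
open import Data.Product using (Σ; ∃; _×_; _,_; proj₁; proj₂; swap)
open import Data.Sum using (_⊎_; inj₁; inj₂; [_,_])
import Data.Sum as Sum
open import Data.Vec using ([]; _∷_; here; there; lookup)
open import Function using (_∘_; _⇔_; mk⇔; Equivalence)
open import Function.Definitions using (Injective)
open import Relation.Binary.Definitions using (DecidableEquality)
open import Relation.Binary.PropositionalEquality hiding ([_])
open import Relation.Nullary using (¬_; Dec; yes; no; contradiction; _×-dec_; ¬?)
open import Relation.Nullary.Decidable using (from-yes; _→-dec_)

private variable
  m n t : ℕ

-- Counting in finite subsets

suc∣p-x∣≡∣p∣ : {p : Subset n} {x : Fin n} → x ∈ p → suc ∣ p - x ∣ ≡ ∣ p ∣
suc∣p-x∣≡∣p∣ {p = .inside ∷ p} here = cong suc (cong ∣_∣ (p─⊥≡p p))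
suc∣p-x∣≡∣p∣ {p = inside ∷ p} (there x∈p) = cong suc (suc∣p-x∣≡∣p∣ x∈p)
suc∣p-x∣≡∣p∣ {p = outside ∷ p} (there x∈p) = suc∣p-x∣≡∣p∣ x∈p

x∉p-x : (p : Subset n) (x : Fin n) → x ∉ p - x
x∉p-x (_ ∷ p) zero ()
x∉p-x (_ ∷ p) (suc x) (there x∈p-x) = x∉p-x p x x∈p-x

∣p∣≡0⇒x∉p : {p : Subset n} {x : Fin n} → ∣ p ∣ ≡ 0 → x ∉ p
∣p∣≡0⇒x∉p {p = p} {x} ∣p∣≡0 x∈p = n≮0 (subst (∣ p - x ∣ <_) ∣p∣≡0 (x∈p⇒∣p-x∣<∣p∣ x∈p))

∣p∣≡suc⇒nonempty : {p : Subset n} → ∣ p ∣ ≡ suc m → Nonempty p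
∣p∣≡suc⇒nonempty {n = n} {p = p} ∣p∣≡1+m with nonempty? p
... | yes p≢∅ = p≢∅
... | no p≡∅ = contradiction
  (trans (sym (trans (cong ∣_∣ (Empty-unique p≡∅)) (∣⊥∣≡0 n))) ∣p∣≡1+m) 0≢1+n

∣p∪q∣≡∣p∣+∣q∣ : (p q : Subset n) → (∀ {x} → x ∈ p → x ∉ q) → ∣ p ∪ q ∣ ≡ ∣ p ∣ + ∣ q ∣
∣p∪q∣≡∣p∣+∣q∣ [] [] _ = refl
∣p∪q∣≡∣p∣+∣q∣ (inside ∷ p) (inside ∷ q) disj = contradiction here (disj here)
∣p∪q∣≡∣p∣+∣q∣ (inside ∷ p) (outside ∷ q) disj =
  cong suc (∣p∪q∣≡∣p∣+∣q∣ p q (λ x∈p → disj (there x∈p) ∘ there))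
∣p∪q∣≡∣p∣+∣q∣ (outside ∷ p) (inside ∷ q) disj =
  trans (cong suc (∣p∪q∣≡∣p∣+∣q∣ p q (λ x∈p → disj (there x∈p) ∘ there))) (sym (+-suc ∣ p ∣ ∣ q ∣))
∣p∪q∣≡∣p∣+∣q∣ (outside ∷ p) (outside ∷ q) disj =
  ∣p∪q∣≡∣p∣+∣q∣ p q (λ x∈p → disj (there x∈p) ∘ there)

∣p∪⁅x⁆∣≡1+∣p∣ : {p : Subset n} {x : Fin n} → x ∉ p → ∣ p ∪ ⁅ x ⁆ ∣ ≡ suc ∣ p ∣
∣p∪⁅x⁆∣≡1+∣p∣ {p = p} {x} x∉p = begin
  ∣ p ∪ ⁅ x ⁆ ∣      ≡⟨ ∣p∪q∣≡∣p∣+∣q∣ p ⁅ x ⁆ disjoint ⟩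
  ∣ p ∣ + ∣ ⁅ x ⁆ ∣  ≡⟨ cong (∣ p ∣ +_) (∣⁅x⁆∣≡1 x) ⟩
  ∣ p ∣ + 1          ≡⟨ +-comm ∣ p ∣ 1 ⟩
  suc ∣ p ∣          ∎
  where
  open ≡-Reasoning
  disjoint : ∀ {y} → y ∈ p → y ∉ ⁅ x ⁆
  disjoint y∈p y∈⁅x⁆ = x∉p (subst (_∈ p) (x∈⁅y⁆⇒x≡y x y∈⁅x⁆) y∈p)

image : (Fin t → Fin n) → Subset n
image {t = 0}     f = ⊥
image {t = suc t} f = image (f ∘ suc) ∪ ⁅ f zero ⁆

f[i]∈image : (f : Fin t → Fin n) (i : Fin t) → f i ∈ image f
f[i]∈image f zero    = x∈p∪q⁺ (inj₂ (x∈⁅x⁆ (f zero)))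
f[i]∈image f (suc i) = x∈p∪q⁺ (inj₁ (f[i]∈image (f ∘ suc) i))

∈image⇒∃ : (f : Fin t → Fin n) {x : Fin n} → x ∈ image f → ∃ λ i → f i ≡ x
∈image⇒∃ {t = 0}     f x∈ = contradiction x∈ ∉⊥
∈image⇒∃ {t = suc t} f x∈ with x∈p∪q⁻ (image (f ∘ suc)) ⁅ f zero ⁆ x∈
... | inj₁ x∈′ = let (i , fi≡x) = ∈image⇒∃ (f ∘ suc) x∈′ in suc i , fi≡x
... | inj₂ x∈⁅f0⁆ = zero , sym (x∈⁅y⁆⇒x≡y (f zero) x∈⁅f0⁆)

∣image∣≡t : ∀ {t n} {f : Fin t → Fin n} → Injective _≡_ _≡_ f → ∣ image f ∣ ≡ t
∣image∣≡t {0} {n} _ = ∣⊥∣≡0 n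
∣image∣≡t {suc t} {f = f} f-inj =
  trans (∣p∪⁅x⁆∣≡1+∣p∣ f0∉) (cong suc (∣image∣≡t (λ e → suc-injective (f-inj e))))
  where
  f0∉ : f zero ∉ image (f ∘ suc)
  f0∉ f0∈ = let (i , fi≡f0) = ∈image⇒∃ (f ∘ suc) f0∈ in 0F≢1+i (sym (f-inj fi≡f0))

record Enumeration (p : Subset n) (m : ℕ) : Set where
  field
    elem      : Fin m → Fin n
    elem-inj  : Injective _≡_ _≡_ elem
    elem∈p    : ∀ i → elem i ∈ p
    elem-onto : ∀ {x} → x ∈ p → ∃ λ i → elem i ≡ x

enumerate : (p : Subset n) → ∣ p ∣ ≡ m → Enumeration p m
enumerate {m = 0} p ∣p∣≡0 = record
  { elem      = λ ()
  ; elem-inj  = λ { {()} }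
  ; elem∈p    = λ ()
  ; elem-onto = λ x∈p → contradiction x∈p (∣p∣≡0⇒x∉p ∣p∣≡0)
  }
enumerate {n} {suc m} p ∣p∣≡1+m with ∣p∣≡suc⇒nonempty ∣p∣≡1+m
... | x , x∈p = record { elem = elem ; elem-inj = elem-inj ; elem∈p = elem∈p ; elem-onto = elem-onto }
  where
  module Rest = Enumeration (enumerate (p - x) (ℕ-suc-injective (trans (suc∣p-x∣≡∣p∣ {p = p} x∈p) ∣p∣≡1+m)))

  elem : Fin (suc m) → Fin n
  elem zero    = x
  elem (suc i) = Rest.elem i

  x≢rest : ∀ i → x ≢ Rest.elem i
  x≢rest i x≡ = x∉p-x p x (subst (_∈ p - x) (sym x≡) (Rest.elem∈p i))

  elem-inj : Injective _≡_ _≡_ elem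
  elem-inj {zero}  {zero}  _ = refl
  elem-inj {zero}  {suc j} e = contradiction e (x≢rest j)
  elem-inj {suc i} {zero}  e = contradiction (sym e) (x≢rest i)
  elem-inj {suc i} {suc j} e = cong suc (Rest.elem-inj e)

  elem∈p : ∀ i → elem i ∈ p
  elem∈p zero    = x∈p
  elem∈p (suc i) = p─q⊆p p ⁅ x ⁆ (Rest.elem∈p i)

  elem-onto : ∀ {y} → y ∈ p → ∃ λ i → elem i ≡ y
  elem-onto {y} y∈p with y ≟ x
  ... | yes y≡x = zero , sym y≡x
  ... | no y≢x  = let (i , e) = Rest.elem-onto (x∈p∧x≢y⇒x∈p-y y∈p y≢x) in suc i , e

-- Maps between finite sets

injective⇒onto : {f : Fin m → Fin n} → Injective _≡_ _≡_ f → m ≡ n → ∀ j → ∃ λ i → f i ≡ j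
injective⇒onto {m = suc _} {f = f} f-inj refl j with any? (λ i → f i ≟ j)
... | yes hit = hit
... | no miss = contradiction (injective⇒≤ punchOut∘f-inj) 1+n≰n
  where
  punchOut∘f : Fin (suc _) → Fin _
  punchOut∘f i = punchOut {i = j} (λ j≡fi → miss (i , sym j≡fi))

  punchOut∘f-inj : Injective _≡_ _≡_ punchOut∘f
  punchOut∘f-inj e = f-inj (punchOut-injective {i = j} _ _ e)

[,]∘splitAt-injective : {A : Set} {f : Fin m → A} {g : Fin t → A} →
  Injective _≡_ _≡_ f → Injective _≡_ _≡_ g → (∀ i j → f i ≢ g j) →
  Injective _≡_ _≡_ ([ f , g ] ∘ splitAt m)
[,]∘splitAt-injective {m = m} {t = t} f-inj g-inj f≢g {i} {j} e
  with splitAt m i in split-i | splitAt m j in split-j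
... | inj₁ x | inj₁ y =
  trans (sym (splitAt⁻¹-↑ˡ split-i)) (trans (cong (_↑ˡ t) (f-inj e)) (splitAt⁻¹-↑ˡ split-j))
... | inj₁ x | inj₂ y = contradiction e (f≢g x y)
... | inj₂ x | inj₁ y = contradiction (sym e) (f≢g y x)
... | inj₂ x | inj₂ y =
  trans (sym (splitAt⁻¹-↑ʳ split-i)) (trans (cong (m ↑ʳ_) (g-inj e)) (splitAt⁻¹-↑ʳ split-j))

DisjointPairs : (p q : Fin t → Fin m) → Set
DisjointPairs p q =
  (∀ s s′ → p s ≡ p s′ → s ≡ s′) × (∀ s s′ → q s ≡ q s′ → s ≡ s′) × (∀ s s′ → p s ≢ q s′)

disjointPairs? : (p q : Fin t → Fin m) → Dec (DisjointPairs p q)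
disjointPairs? p q = injective? p ×-dec injective? q ×-dec (all? λ s → all? λ s′ → ¬? (p s ≟ q s′))
  where
  injective? : (f : Fin _ → Fin _) → Dec (∀ s s′ → f s ≡ f s′ → s ≡ s′)
  injective? f = all? λ s → all? λ s′ → (f s ≟ f s′) →-dec (s ≟ s′)

module Collapse {A : Set} (_≟ᴬ_ : DecidableEquality A) (p q : Fin t → A) where

  collapse : A → A
  collapse a with any? (λ s → q s ≟ᴬ a)
  ... | yes (s , _) = p s
  ... | no _        = a

  collapse-view : ∀ a → (∃ λ s → q s ≡ a × collapse a ≡ p s) ⊎ ((∀ s → q s ≢ a) × collapse a ≡ a)
  collapse-view a with any? (λ s → q s ≟ᴬ a)
  ... | yes (s , qs≡a) = inj₁ (s , qs≡a , refl)
  ... | no ∄s          = inj₂ ((λ s qs≡a → ∄s (s , qs≡a)) , refl)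

  collapse-q : (∀ s s′ → q s ≡ q s′ → s ≡ s′) → ∀ s → collapse (q s) ≡ p s
  collapse-q q-inj s with collapse-view (q s)
  ... | inj₁ (s′ , qs′≡qs , c≡ps′) = trans c≡ps′ (cong p (q-inj s′ s qs′≡qs))
  ... | inj₂ (q≢ , _)              = contradiction refl (q≢ s)

  collapse≢q : (∀ s s′ → p s ≢ q s′) → ∀ a s → collapse a ≢ q s
  collapse≢q p≢q a s c≡qs with collapse-view a
  ... | inj₁ (s′ , _ , c≡ps′) = p≢q s′ s (trans (sym c≡ps′) c≡qs)
  ... | inj₂ (q≢ , c≡a)       = q≢ s (sym (trans (sym c≡a) c≡qs))

  collapse-idem : (∀ s s′ → p s ≢ q s′) → ∀ a → collapse (collapse a) ≡ collapse a
  collapse-idem p≢q a with collapse-view (collapse a)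
  ... | inj₁ (s , qs≡c , _) = contradiction (sym qs≡c) (collapse≢q p≢q a s)
  ... | inj₂ (_ , cc≡c)     = cc≡c

  collapse-fibres : (∀ s s′ → p s ≡ p s′ → s ≡ s′) → ∀ {u v} → collapse u ≡ collapse v →
    u ≡ v ⊎ ∃ λ s → (u ≡ q s × v ≡ p s) ⊎ (u ≡ p s × v ≡ q s)
  collapse-fibres p-inj {u} {v} cu≡cv with collapse-view u | collapse-view v
  ... | inj₁ (s , qs≡u , cu≡ps) | inj₁ (s′ , qs′≡v , cv≡ps′) =
    inj₁ (trans (sym qs≡u) (trans (cong q (p-inj s s′ (trans (sym cu≡ps) (trans cu≡cv cv≡ps′)))) qs′≡v))
  ... | inj₁ (s , qs≡u , cu≡ps) | inj₂ (_ , cv≡v) =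
    inj₂ (s , inj₁ (sym qs≡u , trans (sym cv≡v) (trans (sym cu≡cv) cu≡ps)))
  ... | inj₂ (_ , cu≡u) | inj₁ (s , qs≡v , cv≡ps) =
    inj₂ (s , inj₂ (trans (sym cu≡u) (trans cu≡cv cv≡ps) , sym qs≡v))
  ... | inj₂ (_ , cu≡u) | inj₂ (_ , cv≡v) = inj₁ (trans (sym cu≡u) (trans cu≡cv cv≡v))

module _ {A B : Set} (_≟ᴬ_ : DecidableEquality A) (_≟ᴮ_ : DecidableEquality B)
         (p q : Fin t → A) (f : A → B) where
  private
    module Cᴬ = Collapse _≟ᴬ_ p q
    module Cᴮ = Collapse _≟ᴮ_ (f ∘ p) (f ∘ q)

  collapse-∘ : Injective _≡_ _≡_ f → (∀ s s′ → q s ≡ q s′ → s ≡ s′) →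
    ∀ a → Cᴮ.collapse (f a) ≡ f (Cᴬ.collapse a)
  collapse-∘ f-inj q-inj a with Cᴮ.collapse-view (f a)
  ... | inj₁ (s , fqs≡fa , c≡fps) = begin
    Cᴮ.collapse (f a)      ≡⟨ c≡fps ⟩
    f (p s)                ≡⟨ cong f (Cᴬ.collapse-q q-inj s) ⟨
    f (Cᴬ.collapse (q s))  ≡⟨ cong (f ∘ Cᴬ.collapse) (f-inj fqs≡fa) ⟩
    f (Cᴬ.collapse a)      ∎
    where open ≡-Reasoning
  ... | inj₂ (fq≢fa , c≡fa) with Cᴬ.collapse-view a
  ...   | inj₁ (s , qs≡a , _) = contradiction (cong f qs≡a) (fq≢fa s)
  ...   | inj₂ (_ , ca≡a)     = trans c≡fa (cong f (sym ca≡a))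

-- Adjacency, twins and distances

module _ {n : ℕ} (G : Graph n) where
  open Graph G using (adj; irrefl)

  private variable
    u v x y z : Fin n
    S : Fin n → Set
    d e k : ℕ

  Adj? : ∀ u v → Dec (Adj G u v)
  Adj? u v = adj u v ≟ᵇ true

  Adj-sym : Adj G u v → Adj G v u
  Adj-sym {u} {v} = trans (Graph.sym G v u)

  ¬Adj-refl : ¬ Adj G u u
  ¬Adj-refl {u} u~u = contradiction (trans (sym (irrefl u)) u~u) λ ()

  adj-≡ : Adj G u z → Adj G v z → adj u z ≡ adj v z
  adj-≡ u~z v~z = trans u~z (sym v~z)

  ¬adj-≡ : ¬ Adj G u z → ¬ Adj G v z → adj u z ≡ adj v z
  ¬adj-≡ u≁z v≁z = trans (¬-not u≁z) (sym (¬-not v≁z))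

  twins-sym : Twins G u v → Twins G v u
  twins-sym tw w w≢v w≢u = sym (tw w w≢u w≢v)

  twins-adj : Twins G u v → z ≢ u → z ≢ v → Adj G u z → Adj G v z
  twins-adj tw z≢u z≢v = trans (sym (tw _ z≢u z≢v))

  walk-preserves : (T : Fin n → Set) → (∀ {x y} → T x → Adj G x y → T y) → T u → Walk G u v k → T v
  walk-preserves T step Tu nil = Tu
  walk-preserves T step Tu (cons u~y walk) = walk-preserves T step (step Tu u~y) walk

  walk0⇒≡ : Walk G u v 0 → u ≡ v
  walk0⇒≡ nil = refl

  dist-unique : DistToSet G S u d → DistToSet G S u e → d ≡ e
  dist-unique ((w , Sw , walk) , d-min) ((w′ , Sw′ , walk′) , e-min) =
    ≤-antisym (d-min w′ _ Sw′ walk′) (e-min w _ Sw walk)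

  dist-transfer : DistToSet G S u e → DistToSet G S v e → DistToSet G S u d → DistToSet G S v d
  dist-transfer du dv du′ = subst (DistToSet G _ _) (dist-unique du du′) dv

  dist-0 : S u → DistToSet G S u 0
  dist-0 {u = u} Su = (u , Su , nil) , λ _ _ _ _ → z≤n

  dist-1 : ¬ S u → S z → Adj G u z → DistToSet G S u 1
  dist-1 {S = S} {u} {z} ¬Su Sz u~z = (z , Sz , cons u~z nil) , at-least-1
    where
    at-least-1 : ∀ w k → S w → Walk G u w k → 1 ≤ k
    at-least-1 _ _ Sw nil        = contradiction Sw ¬Su
    at-least-1 _ _ _  (cons _ _) = s≤s z≤n

  ¬dist-1 : (∀ z → S z → ¬ Adj G u z) → ¬ DistToSet G S u 1
  ¬dist-1 no-edge ((z , Sz , cons u~z nil) , _) = no-edge z Sz u~z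

  private
    Shortcut : (Fin n → Set) → Fin n → Fin n → Set
    Shortcut S u v = ∀ {w k} → S w → Walk G u w k → ∃ λ k′ → k′ ≤ k × Walk G v w k′

    twins⇒shortcut : Twins G u v → ¬ S u → Shortcut S u v
    twins⇒shortcut tw ¬Su Sw nil = contradiction Sw ¬Su
    twins⇒shortcut {u} {v} tw ¬Su Sw (cons {v = y} u~y walk) with y ≟ v
    ... | yes refl = _ , n≤1+n _ , walk
    ... | no y≢v   = _ , ≤-refl , cons (twins-adj tw y≢u y≢v u~y) walk
      where
      y≢u : y ≢ u
      y≢u refl = ¬Adj-refl u~y

    shortcut⇒dist : Shortcut S u v → Shortcut S v u → DistToSet G S u d → DistToSet G S v d
    shortcut⇒dist {S = S} {u} {v} {d} u⇝v v⇝u ((w , Sw , walk) , d-min) with u⇝v Sw walk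
    ... | k′ , k′≤d , walk′ = (w , Sw , subst (Walk G _ w) k′≡d walk′) , v-min
      where
      v-min : ∀ w k → S w → Walk G v w k → d ≤ k
      v-min w k Sw walk with v⇝u Sw walk
      ... | k″ , k″≤k , walk″ = ≤-trans (d-min w k″ Sw walk″) k″≤k
      k′≡d : k′ ≡ d
      k′≡d = ≤-antisym k′≤d (v-min w k′ Sw walk′)

  twins⇒dist : Twins G u v → ¬ S u → ¬ S v → DistToSet G S u d → DistToSet G S v d
  twins⇒dist tw ¬Su ¬Sv = shortcut⇒dist (twins⇒shortcut tw ¬Su) (twins⇒shortcut (twins-sym tw) ¬Sv)

  module _ {k : ℕ} (P : Partition G k) where
    open Partition P

    sameRep-sym : SameRep G P u v → SameRep G P v u
    sameRep-sym sr i d = swap (sr i d)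

    sameRep-intro : (∀ i → ∃ λ d → DistToSet G (Class G P i) u d × DistToSet G (Class G P i) v d) →
                    SameRep G P u v
    sameRep-intro common i _ with common i
    ... | _ , du , dv = dist-transfer du dv , dist-transfer dv du

    sameRep⇒sameClass : SameRep G P u v → cls u ≡ cls v
    sameRep⇒sameClass {u} sr with proj₁ (sr (cls u) 0) (dist-0 refl)
    ... | (w , cw≡cu , walk) , _ = sym (trans (cong cls (walk0⇒≡ walk)) cw≡cu)

    twins⇒sameRep : Twins G u v → cls u ≡ cls v → SameRep G P u v
    twins⇒sameRep {u} {v} tw cu≡cv i _ with cls u ≟ i
    ... | yes cu≡i = dist-transfer (dist-0 cu≡i) (dist-0 cv≡i) , dist-transfer (dist-0 cv≡i) (dist-0 cu≡i)
      where
      cv≡i : cls v ≡ i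
      cv≡i = trans (sym cu≡cv) cu≡i
    ... | no cu≢i = twins⇒dist tw cu≢i cv≢i , twins⇒dist (twins-sym tw) cv≢i cu≢i
      where
      cv≢i : cls v ≢ i
      cv≢i cv≡i = cu≢i (trans cu≡cv cv≡i)

    locating⇒twins-apart : IsLocating G P → Twins G u v → cls u ≡ cls v → u ≡ v
    locating⇒twins-apart loc tw cu≡cv = loc _ _ (twins⇒sameRep tw cu≡cv)

    Separated : Fin n → Fin n → Set
    Separated u v =
      ∃ λ i → cls u ≢ i × (∃ λ z → cls z ≡ i × Adj G u z) × (∀ y → cls y ≡ i → ¬ Adj G v y)

    separated⇒¬sameRep : Separated u v → ¬ SameRep G P u v
    separated⇒¬sameRep (i , cu≢i , (z , cz≡i , u~z) , v≁i) sr =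
      ¬dist-1 v≁i (proj₁ (sr i 1) (dist-1 cu≢i cz≡i u~z))

    classmates-separated⇒locating :
      (∀ u v → cls u ≡ cls v → u ≡ v ⊎ Separated u v ⊎ Separated v u) → IsLocating G P
    classmates-separated⇒locating separated u v sr with separated u v (sameRep⇒sameClass sr)
    ... | inj₁ u≡v         = u≡v
    ... | inj₂ (inj₁ u∣v) = contradiction sr (separated⇒¬sameRep u∣v)
    ... | inj₂ (inj₂ v∣u) = contradiction (sameRep-sym sr) (separated⇒¬sameRep v∣u)

  fibrePartition : (ρ : Fin n → Fin n) (R : Subset n) → (∀ v → ρ v ∈ R) → (∀ {v} → v ∈ R → ρ v ≡ v) →
    ∣ R ∣ ≡ m → Σ (Partition G m) λ P → ∀ u v → Partition.cls P u ≡ Partition.cls P v ⇔ ρ u ≡ ρ v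
  fibrePartition {m} ρ R ρ∈R ρ-fixes ∣R∣≡m =
    record { cls = cls ; onto = onto } , λ u v → mk⇔ (kernel u v) (kernel⁻ u v)
    where
    open Enumeration (enumerate R ∣R∣≡m)

    cls : Fin n → Fin m
    cls v = proj₁ (elem-onto (ρ∈R v))

    elem-cls : ∀ v → elem (cls v) ≡ ρ v
    elem-cls v = proj₂ (elem-onto (ρ∈R v))

    onto : ∀ i → ∃ λ v → cls v ≡ i
    onto i = elem i , elem-inj (trans (elem-cls (elem i)) (ρ-fixes (elem∈p i)))

    kernel : ∀ u v → cls u ≡ cls v → ρ u ≡ ρ v
    kernel u v cu≡cv = trans (sym (elem-cls u)) (trans (cong elem cu≡cv) (elem-cls v))

    kernel⁻ : ∀ u v → ρ u ≡ ρ v → cls u ≡ cls v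
    kernel⁻ u v ρu≡ρv = elem-inj (trans (elem-cls u) (trans ρu≡ρv (sym (elem-cls v))))

  module _ {W : Subset n} (twins : IsTwinSet G W) (clique : InducesClique G W)
           {a : Fin n} (a∉W : a ∉ W) (W~a : ∀ w → w ∈ W → Adj G w a) where

    ∣W∣<classes : (P : Partition G k) → IsLocating G P → ∣ W ∣ < k
    ∣W∣<classes {k} P loc = ≤∧≢⇒< (injective⇒≤ cls∘elem-inj) ∣W∣≢k
      where
      open Partition P
      open Enumeration (enumerate W refl)

      cls∘elem-inj : Injective _≡_ _≡_ (cls ∘ elem)
      cls∘elem-inj same = elem-inj (locating⇒twins-apart P loc (twins _ _ (elem∈p _) (elem∈p _)) same)

      ∣W∣≢k : ∣ W ∣ ≢ k
      ∣W∣≢k ∣W∣≡k with injective⇒onto cls∘elem-inj ∣W∣≡k (cls a)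
      ... | iₐ , cwₐ≡ca = a∉W (subst (_∈ W) (sym a≡wₐ) (elem∈p iₐ))
        where
        wₐ : Fin n
        wₐ = elem iₐ

        equidistant : ∀ i → ∃ λ d → DistToSet G (Class G P i) a d × DistToSet G (Class G P i) wₐ d
        equidistant i with cls a ≟ i | injective⇒onto cls∘elem-inj ∣W∣≡k i
        ... | yes ca≡i | _ = 0 , dist-0 ca≡i , dist-0 (trans cwₐ≡ca ca≡i)
        ... | no ca≢i | j , cwⱼ≡i =
          1 , dist-1 ca≢i cwⱼ≡i (Adj-sym (W~a _ (elem∈p j))) , dist-1 cwₐ≢i cwⱼ≡i wₐ~wⱼ
          where
          cwₐ≢i : cls wₐ ≢ i
          cwₐ≢i cwₐ≡i = ca≢i (trans (sym cwₐ≡ca) cwₐ≡i)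

          wₐ~wⱼ : Adj G wₐ (elem j)
          wₐ~wⱼ = clique _ _ (elem∈p iₐ) (elem∈p j) (λ wₐ≡wⱼ → cwₐ≢i (trans (cong cls wₐ≡wⱼ) cwⱼ≡i))

        a≡wₐ : a ≡ wₐ
        a≡wₐ = loc a wₐ (sameRep-intro P equidistant)

  -- The partition of V in which each ν (q s) joins ν (p s) and all other classes are singletons.
  module PairMerging {r : ℕ} (ν : Fin r → Fin n) (ν-inj : Injective _≡_ _≡_ ν)
                     (p q : Fin t → Fin r) (disjoint : DisjointPairs p q) where

    private
      p-inj : ∀ s s′ → p s ≡ p s′ → s ≡ s′
      p-inj = proj₁ disjoint

      q-inj : ∀ s s′ → q s ≡ q s′ → s ≡ s′
      q-inj = proj₁ (proj₂ disjoint)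

      p≢q : ∀ s s′ → p s ≢ q s′
      p≢q = proj₂ (proj₂ disjoint)

      module Cᵢ = Collapse _≟_ p q
      module Cᵥ = Collapse _≟_ (ν ∘ p) (ν ∘ q)

    ρᵢ : Fin r → Fin r
    ρᵢ = Cᵢ.collapse

    ρ : Fin n → Fin n
    ρ = Cᵥ.collapse

    private
      νp-inj : ∀ s s′ → ν (p s) ≡ ν (p s′) → s ≡ s′
      νp-inj s s′ e = p-inj s s′ (ν-inj e)

      νq-inj : Injective _≡_ _≡_ (ν ∘ q)
      νq-inj e = q-inj _ _ (ν-inj e)

      R : Subset n
      R = ∁ (image (ν ∘ q))

      ρ∈R : ∀ v → ρ v ∈ R
      ρ∈R v = x∉p⇒x∈∁p λ ρv∈ →
        let (s , νqs≡ρv) = ∈image⇒∃ (ν ∘ q) ρv∈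
        in Cᵥ.collapse≢q (λ s s′ e → p≢q s s′ (ν-inj e)) v s (sym νqs≡ρv)

      ρ-fixes : ∀ {v} → v ∈ R → ρ v ≡ v
      ρ-fixes {v} v∈R with Cᵥ.collapse-view v
      ... | inj₁ (s , νqs≡v , _) =
        contradiction (subst (_∈ image (ν ∘ q)) νqs≡v (f[i]∈image (ν ∘ q) s)) (x∈∁p⇒x∉p v∈R)
      ... | inj₂ (_ , ρv≡v)      = ρv≡v

      ∣R∣≡n∸t : ∣ R ∣ ≡ n ∸ t
      ∣R∣≡n∸t = trans (∣∁p∣≡n∸∣p∣ (image (ν ∘ q))) (cong (n ∸_) (∣image∣≡t νq-inj))

      partition : Σ (Partition G (n ∸ t)) λ P → ∀ u v → Partition.cls P u ≡ Partition.cls P v ⇔ ρ u ≡ ρ v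
      partition = fibrePartition ρ R ρ∈R ρ-fixes ∣R∣≡n∸t

    P : Partition G (n ∸ t)
    P = proj₁ partition

    open Partition P

    sameClass⇒ : cls u ≡ cls v → ρ u ≡ ρ v
    sameClass⇒ = Equivalence.to (proj₂ partition _ _)

    sameClass⇐ : ρ u ≡ ρ v → cls u ≡ cls v
    sameClass⇐ = Equivalence.from (proj₂ partition _ _)

    ρ∘ν : ∀ i → ρ (ν i) ≡ ν (ρᵢ i)
    ρ∘ν = collapse-∘ _≟_ _≟_ p q ν ν-inj q-inj

    sameClass-ν⇒ : ∀ {i j} → cls (ν i) ≡ cls (ν j) → ρᵢ i ≡ ρᵢ j
    sameClass-ν⇒ {i} {j} same = ν-inj (trans (sym (ρ∘ν i)) (trans (sameClass⇒ same) (ρ∘ν j)))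

    sameClass-ν⇐ : ∀ {i j} → ρᵢ i ≡ ρᵢ j → cls (ν i) ≡ cls (ν j)
    sameClass-ν⇐ {i} {j} ρi≡ρj = sameClass⇐ (trans (ρ∘ν i) (trans (cong ν ρi≡ρj) (sym (ρ∘ν j))))

    classmate-ν : ∀ {j} → cls y ≡ cls (ν j) → ∃ λ l → y ≡ ν l × ρᵢ l ≡ ρᵢ j
    classmate-ν {y} {j} same with Cᵥ.collapse-view y | trans (sameClass⇒ same) (ρ∘ν j)
    ... | inj₁ (s , νqs≡y , ρy≡νps) | ρy≡νρj =
      q s , sym νqs≡y , trans (Cᵢ.collapse-q q-inj s) (ν-inj (trans (sym ρy≡νps) ρy≡νρj))
    ... | inj₂ (_ , ρy≡y) | ρy≡νρj = ρᵢ j , trans (sym ρy≡y) ρy≡νρj , Cᵢ.collapse-idem p≢q j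

    SeparatedBy : Fin r → Fin r → Fin r → Set
    SeparatedBy j i i′ =
      ρᵢ i ≢ ρᵢ j × (∃ λ l → ρᵢ l ≡ ρᵢ j × Adj G (ν i) (ν l)) × (∀ l → ρᵢ l ≡ ρᵢ j → ¬ Adj G (ν i′) (ν l))

    separatedBy⇒separated : ∀ {j i i′} → SeparatedBy j i i′ → Separated P (ν i) (ν i′)
    separatedBy⇒separated {j} {i′ = i′} (ρi≢ρj , (l , ρl≡ρj , i~l) , i′≁) =
      cls (ν j) , ρi≢ρj ∘ sameClass-ν⇒ , (ν l , sameClass-ν⇐ ρl≡ρj , i~l) , i′≁class
      where
      i′≁class : ∀ y → cls y ≡ cls (ν j) → ¬ Adj G (ν i′) y
      i′≁class y same with classmate-ν same
      ... | l′ , refl , ρl′≡ρj = i′≁ l′ ρl′≡ρj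

    PairsSeparated : Set
    PairsSeparated = ∀ s → (∃ λ j → SeparatedBy j (q s) (p s)) ⊎ (∃ λ j → SeparatedBy j (p s) (q s))

    locating : PairsSeparated → Σ (Partition G (n ∸ t)) (IsLocating G)
    locating separated = P , classmates-separated⇒locating P classmates
      where
      pair-separated : ∀ s → Separated P (ν (q s)) (ν (p s)) ⊎ Separated P (ν (p s)) (ν (q s))
      pair-separated s = Sum.map (separatedBy⇒separated ∘ proj₂) (separatedBy⇒separated ∘ proj₂) (separated s)

      classmates : ∀ u v → cls u ≡ cls v → u ≡ v ⊎ Separated P u v ⊎ Separated P v u
      classmates u v same with Cᵥ.collapse-fibres νp-inj (sameClass⇒ same)
      ... | inj₁ u≡v                      = inj₁ u≡v
      ... | inj₂ (s , inj₁ (refl , refl)) = inj₂ (pair-separated s)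
      ... | inj₂ (s , inj₂ (refl , refl)) = inj₂ (Sum.swap (pair-separated s))


n∸[n∸4+2]≡2 : 4 ≤ n → n ∸ (n ∸ 4 + 2) ≡ 2
n∸[n∸4+2]≡2 {n} 4≤n = begin
  n ∸ (n ∸ 4 + 2)                  ≡⟨ cong (_∸ (n ∸ 4 + 2)) n≡n∸4+2+2 ⟩
  (n ∸ 4 + 2) + 2 ∸ (n ∸ 4 + 2)    ≡⟨ m+n∸m≡n (n ∸ 4 + 2) 2 ⟩
  2                                ∎
  where
  open ≡-Reasoning
  n≡n∸4+2+2 : n ≡ n ∸ 4 + 2 + 2
  n≡n∸4+2+2 = sym (trans (+-assoc (n ∸ 4) 2 2) (m∸n+n≡m 4≤n))

module Configuration {n : ℕ} (G : Graph n) (W : Subset n)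
                     (twins : IsTwinSet G W) (clique : InducesClique G W) where

  data Role : Set where
    inW inS inR : Role

  Plays : Role → Fin n → Set
  Plays inW v = v ∈ W
  Plays inS v = v ∉ W × (∀ w → w ∈ W → Adj G w v)
  Plays inR v = v ∉ W × (∀ w → w ∈ W → ¬ Adj G w v)

  role : Fin 8 → Role
  role 4F = inS
  role 5F = inS
  role 6F = inR
  role 7F = inR
  role _  = inW

  -- ν names four vertices of W, the vertices a = ν 4F, b = ν 5F of N(W) ∖ W and the
  -- vertices c = ν 6F, d = ν 7F outside N[W]; by ν-covers there are no others outside W.
  record Labelling : Set where
    field
      ν        : Fin 8 → Fin n
      ν-inj    : Injective _≡_ _≡_ ν
      ν-plays  : ∀ i → Plays (role i) (ν i)
      ν-covers : ∀ {v} → v ∉ W → ∃ λ i → ν i ≡ v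

  relabel : (π : Permutation′ 8) → (∀ i → role (π ⟨$⟩ʳ i) ≡ role i) → Labelling → Labelling
  relabel π π-keeps-role L = record
    { ν        = ν ∘ (π ⟨$⟩ʳ_)
    ; ν-inj    = λ e → trans (sym (inverseˡ π)) (trans (cong (π ⟨$⟩ˡ_) (ν-inj e)) (inverseˡ π))
    ; ν-plays  = λ i → subst (λ r → Plays r _) (π-keeps-role i) (ν-plays (π ⟨$⟩ʳ i))
    ; ν-covers = λ v∉W → let (i , νi≡v) = ν-covers v∉W in π ⟨$⟩ˡ i , trans (cong ν (inverseʳ π)) νi≡v
    }
    where open Labelling L

  swapS : Labelling → Labelling
  swapS = relabel (transpose 4F 5F)
    λ { 0F → refl ; 1F → refl ; 2F → refl ; 3F → refl ; 4F → refl ; 5F → refl ; 6F → refl ; 7F → refl }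

  swapR : Labelling → Labelling
  swapR = relabel (transpose 6F 7F)
    λ { 0F → refl ; 1F → refl ; 2F → refl ; 3F → refl ; 4F → refl ; 5F → refl ; 6F → refl ; 7F → refl }

  module Labelled (L : Labelling) where
    open Labelling L

    a : Fin n
    a = ν 4F

    b : Fin n
    b = ν 5F

    c : Fin n
    c = ν 6F

    d : Fin n
    d = ν 7F

    ν≢ : ∀ {i j} → i ≢ j → ν i ≢ ν j
    ν≢ i≢j = i≢j ∘ ν-inj

    a∉W : a ∉ W
    a∉W = proj₁ (ν-plays 4F)

    b∉W : b ∉ W
    b∉W = proj₁ (ν-plays 5F)

    W~a : ∀ {w} → w ∈ W → Adj G w a
    W~a = proj₂ (ν-plays 4F) _

    W~b : ∀ {w} → w ∈ W → Adj G w b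
    W~b = proj₂ (ν-plays 5F) _

    c≁W : ∀ {w} → w ∈ W → ¬ Adj G c w
    c≁W w∈W = proj₂ (ν-plays 6F) _ w∈W ∘ Adj-sym G

    d≁W : ∀ {w} → w ∈ W → ¬ Adj G d w
    d≁W w∈W = proj₂ (ν-plays 7F) _ w∈W ∘ Adj-sym G

    cover : ∀ v → v ∈ W ⊎ v ≡ a ⊎ v ≡ b ⊎ v ≡ c ⊎ v ≡ d
    cover v with v ∈? W
    ... | yes v∈W = inj₁ v∈W
    ... | no v∉W with ν-covers v∉W
    ... | 0F , refl = inj₁ (ν-plays 0F)
    ... | 1F , refl = inj₁ (ν-plays 1F)
    ... | 2F , refl = inj₁ (ν-plays 2F)
    ... | 3F , refl = inj₁ (ν-plays 3F)
    ... | 4F , refl = inj₂ (inj₁ refl)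
    ... | 5F , refl = inj₂ (inj₂ (inj₁ refl))
    ... | 6F , refl = inj₂ (inj₂ (inj₂ (inj₁ refl)))
    ... | 7F , refl = inj₂ (inj₂ (inj₂ (inj₂ refl)))

    -- Classes {w₀, c}, {w₁, b}, {w₂, d} with wᵢ = ν i; the class {w₃} separates the
    -- first and third pairs, the class {a} the second.
    schemeC : ¬ Adj G a b → Σ (Partition G (n ∸ 3)) (IsLocating G)
    schemeC a≁b = locating separated
      where
      p q : Fin 3 → Fin 8
      p = lookup (0F ∷ 1F ∷ 2F ∷ [])
      q = lookup (6F ∷ 5F ∷ 7F ∷ [])
      open PairMerging G ν ν-inj p q (from-yes (disjointPairs? p q))

      separated : PairsSeparated
      separated 0F = inj₂ (3F , (λ ()) , (3F , refl , clique _ _ (ν-plays 0F) (ν-plays 3F) (ν≢ λ ())) ,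
        λ { 3F _ → c≁W (ν-plays 3F) ; 0F () ; 1F () ; 2F () ; 4F () ; 5F () ; 6F () ; 7F () })
      separated 1F = inj₂ (4F , (λ ()) , (4F , refl , W~a (ν-plays 1F)) ,
        λ { 4F _ → a≁b ∘ Adj-sym G ; 0F () ; 1F () ; 2F () ; 3F () ; 5F () ; 6F () ; 7F () })
      separated 2F = inj₂ (3F , (λ ()) , (3F , refl , clique _ _ (ν-plays 2F) (ν-plays 3F) (ν≢ λ ())) ,
        λ { 3F _ → d≁W (ν-plays 3F) ; 0F () ; 1F () ; 2F () ; 4F () ; 5F () ; 6F () ; 7F () })

    -- Classes {w₀, a}, {w₁, b}, {w₂, d}; {c} separates the first two pairs, {w₃} the third.
    schemeB : Adj G a c → Adj G b c → Σ (Partition G (n ∸ 3)) (IsLocating G)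
    schemeB a~c b~c = locating separated
      where
      p q : Fin 3 → Fin 8
      p = lookup (0F ∷ 1F ∷ 2F ∷ [])
      q = lookup (4F ∷ 5F ∷ 7F ∷ [])
      open PairMerging G ν ν-inj p q (from-yes (disjointPairs? p q))

      separated : PairsSeparated
      separated 0F = inj₁ (6F , (λ ()) , (6F , refl , a~c) ,
        λ { 6F _ → c≁W (ν-plays 0F) ∘ Adj-sym G ; 0F () ; 1F () ; 2F () ; 3F () ; 4F () ; 5F () ; 7F () })
      separated 1F = inj₁ (6F , (λ ()) , (6F , refl , b~c) ,
        λ { 6F _ → c≁W (ν-plays 1F) ∘ Adj-sym G ; 0F () ; 1F () ; 2F () ; 3F () ; 4F () ; 5F () ; 7F () })
      separated 2F = inj₂ (3F , (λ ()) , (3F , refl , clique _ _ (ν-plays 2F) (ν-plays 3F) (ν≢ λ ())) ,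
        λ { 3F _ → d≁W (ν-plays 3F) ; 0F () ; 1F () ; 2F () ; 4F () ; 5F () ; 6F () ; 7F () })

    -- Classes {w₀, a}, {w₁, b}, {c, d}; {c, d} separates the first two pairs, {w₀, a} the third.
    schemeA : Adj G a c → ¬ Adj G a d → Adj G b d → Σ (Partition G (n ∸ 3)) (IsLocating G)
    schemeA a~c a≁d b~d = locating separated
      where
      p q : Fin 3 → Fin 8
      p = lookup (0F ∷ 1F ∷ 6F ∷ [])
      q = lookup (4F ∷ 5F ∷ 7F ∷ [])
      open PairMerging G ν ν-inj p q (from-yes (disjointPairs? p q))

      separated : PairsSeparated
      separated 0F = inj₁ (6F , (λ ()) , (6F , refl , a~c) ,
        λ { 6F _ → c≁W (ν-plays 0F) ∘ Adj-sym G ; 7F _ → d≁W (ν-plays 0F) ∘ Adj-sym G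
          ; 0F () ; 1F () ; 2F () ; 3F () ; 4F () ; 5F () })
      separated 1F = inj₁ (6F , (λ ()) , (7F , refl , b~d) ,
        λ { 6F _ → c≁W (ν-plays 1F) ∘ Adj-sym G ; 7F _ → d≁W (ν-plays 1F) ∘ Adj-sym G
          ; 0F () ; 1F () ; 2F () ; 3F () ; 4F () ; 5F () })
      separated 2F = inj₂ (4F , (λ ()) , (4F , refl , Adj-sym G a~c) ,
        λ { 0F _ → d≁W (ν-plays 0F) ; 4F _ → a≁d ∘ Adj-sym G
          ; 1F () ; 2F () ; 3F () ; 5F () ; 6F () ; 7F () })

    -- Under these hypotheses N(b) = W ∪ {a}, so b is a twin of every vertex of W.
    module _ (a~b : Adj G a b) (b≁c : ¬ Adj G b c) (b≁d : ¬ Adj G b d) where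
      private
        W′ : Subset n
        W′ = W ∪ ⁅ b ⁆

        member : ∀ {u} → u ∈ W′ → u ∈ W ⊎ u ≡ b
        member u∈W′ = Sum.map₂ (x∈⁅y⁆⇒x≡y b) (x∈p∪q⁻ W ⁅ b ⁆ u∈W′)

        W-twin-b : ∀ {w} → w ∈ W → Twins G w b
        W-twin-b w∈W z z≢w z≢b with cover z
        ... | inj₁ z∈W                     = adj-≡ G (clique _ _ w∈W z∈W (z≢w ∘ sym)) (Adj-sym G (W~b z∈W))
        ... | inj₂ (inj₁ refl)             = adj-≡ G (W~a w∈W) (Adj-sym G a~b)
        ... | inj₂ (inj₂ (inj₁ refl))        = contradiction refl z≢b
        ... | inj₂ (inj₂ (inj₂ (inj₁ refl))) = ¬adj-≡ G (c≁W w∈W ∘ Adj-sym G) b≁c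
        ... | inj₂ (inj₂ (inj₂ (inj₂ refl))) = ¬adj-≡ G (d≁W w∈W ∘ Adj-sym G) b≁d

        twins-in : ∀ {u v} → u ∈ W′ → v ∈ W′ → Twins G u v
        twins-in u∈W′ v∈W′ with member u∈W′ | member v∈W′
        ... | inj₁ u∈W  | inj₁ v∈W  = twins _ _ u∈W v∈W
        ... | inj₁ u∈W  | inj₂ refl = W-twin-b u∈W
        ... | inj₂ refl | inj₁ v∈W  = twins-sym G (W-twin-b v∈W)
        ... | inj₂ refl | inj₂ refl = λ _ _ _ → refl

        ∉W′ : ∀ {x u} → x ∉ W → x ≢ b → u ∈ W′ → x ≢ u
        ∉W′ x∉W x≢b u∈W′ refl = [ x∉W , x≢b ] (member u∈W′)

        W′~W : ∀ {u z} → u ∈ W′ → z ∈ W → z ≢ u → Adj G u z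
        W′~W u∈W′ z∈W z≢u with member u∈W′
        ... | inj₁ u∈W = clique _ _ u∈W z∈W (z≢u ∘ sym)
        ... | inj₂ refl = Adj-sym G (W~b z∈W)

        W′≁c : ∀ {u} → u ∈ W′ → ¬ Adj G u c
        W′≁c u∈W′ with member u∈W′
        ... | inj₁ u∈W  = c≁W u∈W ∘ Adj-sym G
        ... | inj₂ refl = b≁c

        W′≁d : ∀ {u} → u ∈ W′ → ¬ Adj G u d
        W′≁d u∈W′ with member u∈W′
        ... | inj₁ u∈W  = d≁W u∈W ∘ Adj-sym G
        ... | inj₂ refl = b≁d

        W-vertex-besides : ∀ u → ∃ λ z → z ∈ W × z ≢ u
        W-vertex-besides u with ν 0F ≟ u
        ... | yes refl = ν 1F , ν-plays 1F , ν≢ λ ()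
        ... | no ν0≢u  = ν 0F , ν-plays 0F , ν0≢u

        -- u has a neighbour in W other than itself, x has none
        ¬twin-R : ∀ {u x} → u ∈ W′ → x ∉ W → (∀ {w} → w ∈ W → ¬ Adj G x w) → ¬ Twins G u x
        ¬twin-R {u} u∈W′ x∉W x≁W tw with W-vertex-besides u
        ... | z , z∈W , z≢u =
          x≁W z∈W (twins-adj G tw z≢u (λ z≡x → x∉W (subst (_∈ W) z≡x z∈W)) (W′~W u∈W′ z∈W z≢u))

        ¬twin-a : Adj G a c ⊎ Adj G a d → ∀ {u} → u ∈ W′ → ¬ Twins G u a
        ¬twin-a (inj₁ a~c) u∈W′ tw =
          W′≁c u∈W′ (twins-adj G (twins-sym G tw) (ν≢ λ ()) (∉W′ (proj₁ (ν-plays 6F)) (ν≢ λ ()) u∈W′) a~c)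
        ¬twin-a (inj₂ a~d) u∈W′ tw =
          W′≁d u∈W′ (twins-adj G (twins-sym G tw) (ν≢ λ ()) (∉W′ (proj₁ (ν-plays 7F)) (ν≢ λ ()) u∈W′) a~d)

      W∪⁅b⁆-twinClass : Adj G a c ⊎ Adj G a d → IsTwinClass G (W ∪ ⁅ b ⁆)
      W∪⁅b⁆-twinClass a~R = (b , x∈p∪q⁺ (inj₂ (x∈⁅x⁆ b))) , λ u v u∈W′ → twins-in u∈W′ , closed u∈W′
        where
        closed : ∀ {u v} → u ∈ W′ → Twins G u v → v ∈ W′
        closed {v = v} u∈W′ tw with cover v
        ... | inj₁ v∈W                     = x∈p∪q⁺ (inj₁ v∈W)
        ... | inj₂ (inj₁ refl)             = contradiction tw (¬twin-a a~R u∈W′)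
        ... | inj₂ (inj₂ (inj₁ refl))        = x∈p∪q⁺ (inj₂ (x∈⁅x⁆ b))
        ... | inj₂ (inj₂ (inj₂ (inj₁ refl))) = contradiction tw (¬twin-R u∈W′ (proj₁ (ν-plays 6F)) c≁W)
        ... | inj₂ (inj₂ (inj₂ (inj₂ refl))) = contradiction tw (¬twin-R u∈W′ (proj₁ (ν-plays 7F)) d≁W)

    R-neighbour : ∀ {x y} → y ≡ c ⊎ y ≡ d → x ≢ c → x ≢ d → Adj G x y → x ≡ a ⊎ x ≡ b
    R-neighbour {x} y∈R x≢c x≢d x~y with cover x | y∈R
    ... | inj₁ x∈W | inj₁ refl = contradiction (Adj-sym G x~y) (c≁W x∈W)
    ... | inj₁ x∈W | inj₂ refl = contradiction (Adj-sym G x~y) (d≁W x∈W)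
    ... | inj₂ (inj₁ x≡a) | _ = inj₁ x≡a
    ... | inj₂ (inj₂ (inj₁ x≡b)) | _ = inj₂ x≡b
    ... | inj₂ (inj₂ (inj₂ (inj₁ x≡c))) | _ = contradiction x≡c x≢c
    ... | inj₂ (inj₂ (inj₂ (inj₂ x≡d))) | _ = contradiction x≡d x≢d

    R-unreachable : ¬ Adj G a c → ¬ Adj G a d → ¬ Adj G b c → ¬ Adj G b d → ¬ Connected G
    R-unreachable a≁c a≁d b≁c b≁d connected =
      proj₁ (walk-preserves G T step (ν≢ (λ ()) , ν≢ (λ ())) (proj₂ (connected (ν 0F) c))) refl
      where
      T : Fin n → Set
      T v = v ≢ c × v ≢ d

      step : ∀ {x y} → T x → Adj G x y → T y
      step (x≢c , x≢d) x~y = (λ { refl → [ (λ { refl → a≁c x~y }) , (λ { refl → b≁c x~y }) ]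
                                           (R-neighbour (inj₁ refl) x≢c x≢d x~y) })
                           , (λ { refl → [ (λ { refl → a≁d x~y }) , (λ { refl → b≁d x~y }) ]
                                           (R-neighbour (inj₂ refl) x≢c x≢d x~y) })

  Largest : Set
  Largest = ∀ W′ → IsTwinClass G W′ → ∣ W′ ∣ ≤ ∣ W ∣

  ¬largest : ∀ {v} → v ∉ W → IsTwinClass G (W ∪ ⁅ v ⁆) → ¬ Largest
  ¬largest v∉W twin-class largest = 1+n≰n (subst (_≤ ∣ W ∣) (∣p∪⁅x⁆∣≡1+∣p∣ v∉W) (largest _ twin-class))

  module _ (L : Labelling) where
    open Labelled L

    upperBound : Largest → Connected G → Σ (Partition G (n ∸ 3)) (IsLocating G)
    upperBound largest connected with Adj? G a b
    ... | no a≁b = schemeC a≁b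
    ... | yes a~b with Adj? G a c | Adj? G a d | Adj? G b c | Adj? G b d
    ... | yes a~c | _       | yes b~c | _       = schemeB a~c b~c
    ... | _       | yes a~d | _       | yes b~d = Labelled.schemeB (swapR L) a~d b~d
    ... | yes a~c | no a≁d  | no b≁c  | yes b~d = schemeA a~c a≁d b~d
    ... | no a≁c  | yes a~d | yes b~c | no b≁d  = Labelled.schemeA (swapR L) a~d a≁c b~c
    ... | yes a~c | _       | no b≁c  | no b≁d  =
      contradiction largest (¬largest b∉W (W∪⁅b⁆-twinClass a~b b≁c b≁d (inj₁ a~c)))
    ... | _       | yes a~d | no b≁c  | no b≁d  =
      contradiction largest (¬largest b∉W (W∪⁅b⁆-twinClass a~b b≁c b≁d (inj₂ a~d)))
    ... | no a≁c  | no a≁d  | yes b~c | _       =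
      contradiction largest
        (¬largest a∉W (Labelled.W∪⁅b⁆-twinClass (swapS L) (Adj-sym G a~b) a≁c a≁d (inj₁ b~c)))
    ... | no a≁c  | no a≁d  | _       | yes b~d =
      contradiction largest
        (¬largest a∉W (Labelled.W∪⁅b⁆-twinClass (swapS L) (Adj-sym G a~b) a≁c a≁d (inj₂ b~d)))
    ... | no a≁c  | no a≁d  | no b≁c  | no b≁d  = contradiction connected (R-unreachable a≁c a≁d b≁c b≁d)

  module Extraction (S : Subset n) (S-def : IsOpenNbhdMinus G W S) (∣S∣≡2 : ∣ S ∣ ≡ 2)
                    (∣W∣≡n∸4 : ∣ W ∣ ≡ n ∸ 4) (8≤n : 8 ≤ n) where
    private
      R : Subset n
      R = ∁ (W ∪ S)

      S-plays : ∀ {v} → v ∈ S → Plays inS v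
      S-plays v∈S with proj₁ (S-def _) v∈S
      ... | v∉W , w′ , w′∈W , w′~v =
        v∉W , λ w w∈W → twins-adj G (twins _ _ w′∈W w∈W) (λ v≡w′ → v∉W (subst (_∈ W) (sym v≡w′) w′∈W))
                                                      (λ v≡w → v∉W (subst (_∈ W) (sym v≡w) w∈W)) w′~v

      R-avoids : ∀ {v} → v ∈ R → v ∉ W × v ∉ S
      R-avoids v∈R = x∈∁p⇒x∉p v∈R ∘ x∈p∪q⁺ ∘ inj₁ , x∈∁p⇒x∉p v∈R ∘ x∈p∪q⁺ ∘ inj₂

      R-plays : ∀ {v} → v ∈ R → Plays inR v
      R-plays v∈R with R-avoids v∈R
      ... | v∉W , v∉S = v∉W , λ w w∈W w~v → v∉S (proj₂ (S-def _) (v∉W , w , w∈W , w~v))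

      ∣R∣≡2 : ∣ R ∣ ≡ 2
      ∣R∣≡2 = begin
        ∣ ∁ (W ∪ S) ∣        ≡⟨ ∣∁p∣≡n∸∣p∣ (W ∪ S) ⟩
        n ∸ ∣ W ∪ S ∣        ≡⟨ cong (n ∸_) (∣p∪q∣≡∣p∣+∣q∣ W S (λ v∈W v∈S → proj₁ (S-plays v∈S) v∈W)) ⟩
        n ∸ (∣ W ∣ + ∣ S ∣)  ≡⟨ cong₂ (λ x y → n ∸ (x + y)) ∣W∣≡n∸4 ∣S∣≡2 ⟩
        n ∸ (n ∸ 4 + 2)      ≡⟨ n∸[n∸4+2]≡2 (≤-trans (m≤m+n 4 4) 8≤n) ⟩
        2                    ∎
        where open ≡-Reasoning

      4≤∣W∣ : 4 ≤ ∣ W ∣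
      4≤∣W∣ = subst (4 ≤_) (sym ∣W∣≡n∸4) (∸-monoˡ-≤ 4 8≤n)

      module EW = Enumeration (enumerate W (sym (m+[n∸m]≡n 4≤∣W∣)))
      module ES = Enumeration (enumerate S ∣S∣≡2)
      module ER = Enumeration (enumerate R ∣R∣≡2)

      beyondW : Fin 4 → Fin n
      beyondW = [ ES.elem , ER.elem ] ∘ splitAt 2

      beyondW∉W : ∀ j → beyondW j ∉ W
      beyondW∉W j with splitAt 2 j
      ... | inj₁ i = proj₁ (S-plays (ES.elem∈p i))
      ... | inj₂ i = proj₁ (R-plays (ER.elem∈p i))

      ν : Fin 8 → Fin n
      ν = [ EW.elem ∘ (_↑ˡ (∣ W ∣ ∸ 4)) , beyondW ] ∘ splitAt 4

      ν-inj : Injective _≡_ _≡_ ν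
      ν-inj = [,]∘splitAt-injective (λ e → ↑ˡ-injective (∣ W ∣ ∸ 4) _ _ (EW.elem-inj e)) beyondW-inj
        (λ i j e → beyondW∉W j (subst (_∈ W) e (EW.elem∈p (i ↑ˡ (∣ W ∣ ∸ 4)))))
        where
        beyondW-inj : Injective _≡_ _≡_ beyondW
        beyondW-inj = [,]∘splitAt-injective ES.elem-inj ER.elem-inj
          (λ i j e → proj₂ (R-avoids (ER.elem∈p j)) (subst (_∈ S) e (ES.elem∈p i)))

      ν-plays : ∀ i → Plays (role i) (ν i)
      ν-plays 0F = EW.elem∈p (0F ↑ˡ (∣ W ∣ ∸ 4))
      ν-plays 1F = EW.elem∈p (1F ↑ˡ (∣ W ∣ ∸ 4))
      ν-plays 2F = EW.elem∈p (2F ↑ˡ (∣ W ∣ ∸ 4))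
      ν-plays 3F = EW.elem∈p (3F ↑ˡ (∣ W ∣ ∸ 4))
      ν-plays 4F = S-plays (ES.elem∈p 0F)
      ν-plays 5F = S-plays (ES.elem∈p 1F)
      ν-plays 6F = R-plays (ER.elem∈p 0F)
      ν-plays 7F = R-plays (ER.elem∈p 1F)

      ν-covers : ∀ {v} → v ∉ W → ∃ λ i → ν i ≡ v
      ν-covers {v} v∉W with v ∈? S
      ... | yes v∈S with ES.elem-onto v∈S
      ...   | 0F , e = 4F , e
      ...   | 1F , e = 5F , e
      ν-covers {v} v∉W | no v∉S with ER.elem-onto (x∉p⇒x∈∁p {p = W ∪ S} ([ v∉W , v∉S ] ∘ x∈p∪q⁻ W S))
      ...   | 0F , e = 6F , e
      ...   | 1F , e = 7F , e

    labelling : Labelling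
    labelling = record { ν = ν ; ν-inj = ν-inj ; ν-plays = ν-plays ; ν-covers = ν-covers }

mainTheorem19 : (n : ℕ) → (G : Graph n) → 9 ≤ n → Connected G →
    TauEq G (n ∸ 4) →
    (W : Subset n) → IsTwinSet G W → ∣ W ∣ ≡ n ∸ 4 → InducesClique G W →
    (S : Subset n) → IsOpenNbhdMinus G W S → ∣ S ∣ ≡ 2 →
    PartitionDimEq G (n ∸ 3)
mainTheorem19 n G 9≤n connected (_ , τ-maximal) W twins ∣W∣≡n∸4 clique S S-def ∣S∣≡2 =
  upperBound L largest connected , lowerBound
  where
  open Configuration G W twins clique
  open Labelled using (a∉W; W~a)

  L : Labelling
  L = Extraction.labelling S S-def ∣S∣≡2 ∣W∣≡n∸4 (≤-trans (n≤1+n 8) 9≤n)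

  largest : Largest
  largest W′ twin-class = subst (∣ W′ ∣ ≤_) (sym ∣W∣≡n∸4) (τ-maximal W′ twin-class)

  lowerBound : ∀ k (P : Partition G k) → IsLocating G P → n ∸ 3 ≤ k
  lowerBound k P loc =
    subst (_≤ k) (trans (cong suc ∣W∣≡n∸4) (sym (+-∸-assoc 1 (≤-trans (m≤m+n 4 5) 9≤n))))
      (∣W∣<classes G twins clique (a∉W L) (λ _ → W~a L) P loc)
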